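{- (Design Composition Theorem II) For any two finite designs $D=\{m\}_n$ and $D'=\{m'\}_{n'}$, \[ U(DD')=U(D)\,U(D'), \] where $DD'=\{2^{n'}m+m'\}_{n+n'}$ is the concatenated word.
   Context: Stern's diatomic integers: for integers $n\ge0$, $0\le m\le 2^n$, define $[2^0:0]=0$, $[2^0:1]=1$, $[2^{n+1}:2m]=[2^n:m]$ ($0\le m\le 2^n$), $[2^{n+1}:2m+1]=[2^n:m]+[2^n:m+1]$ ($0\le m\le 2^n-1$). A finite design $\{m\}_n$ ($n\ge0$, $0\le m\le 2^n-1$) is the binary word of length $n$ (leading zeros allowed; $\{0\}_0$ is the empty word) representing $m$. For such a design, $U(\{m\}_n)=\begin{pmatrix}[2^n:m+1]&[2^n:m]\\ [2^n:2^n-(m+1)]&[2^n:2^n-m]\end{pmatrix}$. -}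

module Defs where

open import Data.Nat using (ℕ; zero; suc; _+_; _*_; _^_; _<_)
open import Data.Nat.Properties using (+-suc)
open import Relation.Binary.PropositionalEquality using (subst; cong)

data Parity : ℕ → Set where
  even : (k : ℕ) → Parity (k + k)
  odd  : (k : ℕ) → Parity (suc (k + k))

parity : (m : ℕ) → Parity m
parity zero = even zero
parity (suc m) with parity m
... | even k = odd k
... | odd k = subst Parity (cong suc (+-suc k k)) (even (suc k))

-- Stern's diatomic integers [2^n : m].  Defined as a total function;
-- only the values with 0 ≤ m ≤ 2^n are meaningful (other values are 0/junk
-- and never used in the statement).
--   [2^0:0] = 0, [2^0:1] = 1,
--   [2^(n+1):2k] = [2^n:k],  [2^(n+1):2k+1] = [2^n:k] + [2^n:k+1].
stern : ℕ → ℕ → ℕ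
stern zero zero = 0
stern zero (suc zero) = 1
stern zero (suc (suc _)) = 0
stern (suc n) m with parity m
... | even k = stern n k
... | odd k = stern n k + stern n (suc k)

record Mat2 : Set where
  constructor mat
  field
    a b c d : ℕ

open Mat2 public

_⊗_ : Mat2 → Mat2 → Mat2
mat a₁ b₁ c₁ d₁ ⊗ mat a₂ b₂ c₂ d₂ =
  mat (a₁ * a₂ + b₁ * c₂) (a₁ * b₂ + b₁ * d₂)
      (c₁ * a₂ + d₁ * c₂) (c₁ * b₂ + d₁ * d₂)

-- Subtraction 2^n - x (used with x ≤ 2^n only).
open import Data.Nat using (_∸_)

U : (n m : ℕ) → Mat2
U n m = mat (stern n (suc m)) (stern n m)
            (stern n (2 ^ n ∸ suc m)) (stern n (2 ^ n ∸ m))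

{-# OPTIONS --safe #-}
-- Reading a design bit by bit, appending a bit b to a design multiplies U on the right by
-- the fixed matrix L = (1 0; 1 1) for b = 0 and R = (1 1; 0 1) for b = 1: both rows of U
-- are pairs of consecutive Stern numbers (the bottom row at the complement 2ⁿ - m - 1,
-- whose last bit is the opposite one), and the Stern recursion acts on such a pair exactly
-- as L or R.  Hence U of a word is the product of the bit matrices, and concatenating
-- words multiplies these products.
module Submission where

open import Defs
open import Data.Bool using (Bool; false; true; not)
open import Data.Empty using (⊥-elim)
open import Data.Nat using (ℕ; zero; suc; _+_; _*_; _^_; _∸_; _<_; _≤_; s≤s)
open import Data.Nat.Properties
open import Data.Nat.Tactic.RingSolver using (solve-∀)
open import Data.Product using (∃₂; _,_)
open import Relation.Binary.PropositionalEquality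

double≡2* : ∀ k → k + k ≡ 2 * k
double≡2* k = cong (k +_) (sym (+-identityʳ k))

double-injective : ∀ {j k} → j + j ≡ k + k → j ≡ k
double-injective {j} {k} eq =
  *-cancelˡ-≡ j k 2 (trans (sym (double≡2* j)) (trans eq (double≡2* k)))

double≢suc-double : ∀ j k → j + j ≢ suc (k + k)
double≢suc-double j k eq =
  even≢odd j k (trans (sym (double≡2* j)) (trans eq (cong suc (double≡2* k))))

stern-suc-double : ∀ n {m} k → m ≡ k + k → stern (suc n) m ≡ stern n k
stern-suc-double n {m} k eq with parity m
... | even j = cong (stern n) (double-injective eq)
... | odd j  = ⊥-elim (double≢suc-double k j (sym eq))

stern-suc-double+1 : ∀ n {m} k → m ≡ suc (k + k) →
  stern (suc n) m ≡ stern n k + stern n (suc k)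
stern-suc-double+1 n {m} k eq with parity m
... | even j = ⊥-elim (double≢suc-double j k eq)
... | odd j = cong (λ i → stern n i + stern n (suc i)) (double-injective (suc-injective eq))

snoc : Bool → ℕ → ℕ
snoc false k = k + k
snoc true  k = suc (k + k)

snoc-view : ∀ m → ∃₂ λ b k → snoc b k ≡ m
snoc-view m with parity m
... | even k = false , k , refl
... | odd k  = true , k , refl

bitMatrix : Bool → Mat2
bitMatrix false = mat 1 0 1 1
bitMatrix true  = mat 1 1 0 1

mat-cong : ∀ {a b c d a′ b′ c′ d′} → a ≡ a′ → b ≡ b′ → c ≡ c′ → d ≡ d′ →
  mat a b c d ≡ mat a′ b′ c′ d′
mat-cong refl refl refl refl = refl

⊗-assoc : ∀ X Y Z → (X ⊗ Y) ⊗ Z ≡ X ⊗ (Y ⊗ Z)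
⊗-assoc (mat a b c d) (mat e f g h) (mat i j k l) =
  mat-cong (entry a b e f g h i k) (entry a b e f g h j l)
           (entry c d e f g h i k) (entry c d e f g h j l)
  where
  entry : ∀ x y e f g h i k → (x * e + y * g) * i + (x * f + y * h) * k ≡
                              x * (e * i + f * k) + y * (g * i + h * k)
  entry = solve-∀

⊗-identityʳ : ∀ X → X ⊗ mat 1 0 0 1 ≡ X
⊗-identityʳ (mat a b c d) = mat-cong (first a b) (second a b) (first c d) (second c d)
  where
  first : ∀ x y → x * 1 + y * 0 ≡ x
  first = solve-∀
  second : ∀ x y → x * 0 + y * 1 ≡ y
  second = solve-∀

⊗-bitMatrix-false : ∀ a b c d → mat a b c d ⊗ bitMatrix false ≡ mat (a + b) b (c + d) d
⊗-bitMatrix-false a b c d = mat-cong (sum a b) (right a b) (sum c d) (right c d)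
  where
  sum : ∀ x y → x * 1 + y * 1 ≡ x + y
  sum = solve-∀
  right : ∀ x y → x * 0 + y * 1 ≡ y
  right = solve-∀

⊗-bitMatrix-true : ∀ a b c d → mat a b c d ⊗ bitMatrix true ≡ mat a (a + b) c (c + d)
⊗-bitMatrix-true a b c d = mat-cong (left a b) (sum a b) (left c d) (sum c d)
  where
  left : ∀ x y → x * 1 + y * 0 ≡ x
  left = solve-∀
  sum : ∀ x y → x * 1 + y * 1 ≡ x + y
  sum = solve-∀

-- U n k with the complement r = 2ⁿ - k - 1 as an independent argument, freeing it of ∸.
sternMatrix : ℕ → ℕ → ℕ → Mat2
sternMatrix n k r = mat (stern n (suc k)) (stern n k) (stern n r) (stern n (suc r))

U≡sternMatrix : ∀ {n k r} → suc (k + r) ≡ 2 ^ n → U n k ≡ sternMatrix n k r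
U≡sternMatrix {n} {k} {r} eq = mat-cong refl refl
  (cong (stern n) (trans (cong (_∸ suc k) (sym eq)) (m+n∸m≡n (suc k) r)))
  (cong (stern n) (trans (cong (_∸ k) (sym (trans (+-suc k r) eq))) (m+n∸m≡n k (suc r))))

snoc-complement : ∀ b {k r N} → suc (k + r) ≡ N → suc (snoc b k + snoc (not b) r) ≡ 2 * N
snoc-complement false {k} {r} refl = identity k r
  where
  identity : ∀ k r → suc (k + k + suc (r + r)) ≡ 2 * suc (k + r)
  identity = solve-∀
snoc-complement true {k} {r} refl = identity k r
  where
  identity : ∀ k r → suc (suc (k + k + (r + r))) ≡ 2 * suc (k + r)
  identity = solve-∀

sternMatrix-snoc : ∀ n b k r →
  sternMatrix (suc n) (snoc b k) (snoc (not b) r) ≡ sternMatrix n k r ⊗ bitMatrix b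
sternMatrix-snoc n false k r = begin
    sternMatrix (suc n) (k + k) (suc (r + r))
  ≡⟨ mat-cong (trans (stern-suc-double+1 n k refl) (+-comm (s k) _))
              (stern-suc-double n k refl)
              (stern-suc-double+1 n r refl)
              (stern-suc-double n (suc r) (cong suc (sym (+-suc r r)))) ⟩
    mat (s (suc k) + s k) (s k) (s r + s (suc r)) (s (suc r))
  ≡⟨ sym (⊗-bitMatrix-false _ _ _ _) ⟩
    sternMatrix n k r ⊗ bitMatrix false ∎
  where
  open ≡-Reasoning
  s = stern n
sternMatrix-snoc n true k r = begin
    sternMatrix (suc n) (suc (k + k)) (r + r)
  ≡⟨ mat-cong (stern-suc-double n (suc k) (cong suc (sym (+-suc k k))))
              (trans (stern-suc-double+1 n k refl) (+-comm (s k) _))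
              (stern-suc-double n r refl)
              (stern-suc-double+1 n r refl) ⟩
    mat (s (suc k)) (s (suc k) + s k) (s r) (s r + s (suc r))
  ≡⟨ sym (⊗-bitMatrix-true _ _ _ _) ⟩
    sternMatrix n k r ⊗ bitMatrix true ∎
  where
  open ≡-Reasoning
  s = stern n

U-snoc : ∀ n b k → k < 2 ^ n → U (suc n) (snoc b k) ≡ U n k ⊗ bitMatrix b
U-snoc n b k k<2ⁿ with m≤n⇒∃[o]m+o≡n k<2ⁿ
... | r , complement = begin
    U (suc n) (snoc b k)
  ≡⟨ U≡sternMatrix {suc n} (snoc-complement b complement) ⟩
    sternMatrix (suc n) (snoc b k) (snoc (not b) r)
  ≡⟨ sternMatrix-snoc n b k r ⟩
    sternMatrix n k r ⊗ bitMatrix b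
  ≡⟨ cong (_⊗ bitMatrix b) (sym (U≡sternMatrix {n} complement)) ⟩
    U n k ⊗ bitMatrix b ∎
  where open ≡-Reasoning

snoc-<⇒< : ∀ b {k N} → snoc b k < 2 * N → k < N
snoc-<⇒< b {k} {N} lt = *-cancelˡ-< 2 k N (≤-<-trans (2*≤snoc b) lt)
  where
  2*≤snoc : ∀ b → 2 * k ≤ snoc b k
  2*≤snoc false = ≤-reflexive (sym (double≡2* k))
  2*≤snoc true  = m≤n⇒m≤1+n (≤-reflexive (sym (double≡2* k)))

*-+-snoc : ∀ b P m k → 2 * P * m + snoc b k ≡ snoc b (P * m + k)
*-+-snoc false P m k = identity P m k
  where
  identity : ∀ P m k → 2 * P * m + (k + k) ≡ P * m + k + (P * m + k)
  identity = solve-∀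
*-+-snoc true P m k = identity P m k
  where
  identity : ∀ P m k → 2 * P * m + suc (k + k) ≡ suc (P * m + k + (P * m + k))
  identity = solve-∀

*-+-<-* : ∀ {m k M K} → m < M → k < K → K * m + k < M * K
*-+-<-* {m} {k} {M} {K} m<M k<K = begin-strict
    K * m + k   <⟨ +-monoʳ-< (K * m) k<K ⟩
    K * m + K   ≡⟨ +-comm (K * m) K ⟩
    K + K * m   ≡⟨ sym (*-suc K m) ⟩
    K * suc m   ≤⟨ *-monoʳ-≤ K m<M ⟩
    K * M       ≡⟨ *-comm K M ⟩
    M * K       ∎
  where open ≤-Reasoning

theorem6p12 : (n m n′ m′ : ℕ) → m < 2 ^ n → m′ < 2 ^ n′ →
    U (n + n′) (2 ^ n′ * m + m′) ≡ U n m ⊗ U n′ m′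
theorem6p12 n m zero zero m<2ⁿ _ =
  trans (cong₂ U (+-identityʳ n) (trans (+-identityʳ _) (*-identityˡ m)))
        (sym (⊗-identityʳ (U n m)))
theorem6p12 n m zero (suc m′) m<2ⁿ (s≤s ())
theorem6p12 n m (suc n′) m′ m<2ⁿ m′<2ⁿ′ with snoc-view m′
... | b , k , refl = begin
    U (n + suc n′) (2 * 2 ^ n′ * m + snoc b k)
  ≡⟨ cong₂ U (+-suc n n′) (*-+-snoc b (2 ^ n′) m k) ⟩
    U (suc (n + n′)) (snoc b (2 ^ n′ * m + k))
  ≡⟨ U-snoc (n + n′) b _ concatenation-bound ⟩
    U (n + n′) (2 ^ n′ * m + k) ⊗ bitMatrix b
  ≡⟨ cong (_⊗ bitMatrix b) (theorem6p12 n m n′ k m<2ⁿ k<2ⁿ′) ⟩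
    (U n m ⊗ U n′ k) ⊗ bitMatrix b
  ≡⟨ ⊗-assoc (U n m) (U n′ k) (bitMatrix b) ⟩
    U n m ⊗ (U n′ k ⊗ bitMatrix b)
  ≡⟨ cong (U n m ⊗_) (sym (U-snoc n′ b k k<2ⁿ′)) ⟩
    U n m ⊗ U (suc n′) (snoc b k) ∎
  where
  open ≡-Reasoning
  k<2ⁿ′ : k < 2 ^ n′
  k<2ⁿ′ = snoc-<⇒< b m′<2ⁿ′
  concatenation-bound : 2 ^ n′ * m + k < 2 ^ (n + n′)
  concatenation-bound =
    subst (_ <_) (sym (^-distribˡ-+-* 2 n n′)) (*-+-<-* m<2ⁿ k<2ⁿ′)
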